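{- Let $n,a,b$ be natural numbers with $n\ge a+b$. If $u$ and $v$ are binary words of lengths $n-a$ and $n-b$ respectively with $\mathrm{SCS}(u,v)=n$ (equivalently, $\mathrm{LCS}(u,v)=n-a-b$), then \[ m_{\mathsf{LCS}}(u,v)\le m_{\mathsf{SCS}}(u,v)\le\binom{a+b}{a}. \]
   Context: Words are finite strings over $\{0,1\}$. $w$ is a subsequence of $u$ (and $u$ a supersequence of $w$) if $w$ is obtained from $u$ by deleting some letters. $\mathrm{LCS}(u,v)$ is the maximum length of a common subsequence of $u,v$ and $\mathrm{SCS}(u,v)$ the minimum length of a common supersequence; an LCS (resp. SCS) is a common subsequence (resp. supersequence) of that length. $m_{\mathsf{LCS}}(u,v)$ (resp. $m_{\mathsf{SCS}}(u,v)$) is the number of distinct LCS's (resp. SCS's) of $u$ and $v$. -}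

module Defs where

open import Data.Bool using (Bool)
open import Data.List using (List; length)
open import Data.Nat using (ℕ; _≤_)
open import Data.Product using (_×_; ∃; ∃-syntax)
open import Data.List.Relation.Binary.Sublist.Propositional using (_⊆_)
open import Data.List.Relation.Unary.Unique.Propositional using (Unique)
open import Data.List.Membership.Propositional using (_∈_)
open import Function.Bundles using (_⇔_)
open import Relation.Binary.PropositionalEquality using (_≡_)

Word : Set
Word = List Bool

-- w is a subsequence of u  is  w ⊆ u  (stdlib sublist relation).

CommonSub : Word → Word → Word → Set
CommonSub u v w = (w ⊆ u) × (w ⊆ v)

CommonSuper : Word → Word → Word → Set
CommonSuper u v w = (u ⊆ w) × (v ⊆ w)

LCSLength : Word → Word → ℕ → Set
LCSLength u v k =
  (∃[ w ] (CommonSub u v w × length w ≡ k)) × (∀ w → CommonSub u v w → length w ≤ k)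

SCSLength : Word → Word → ℕ → Set
SCSLength u v k =
  (∃[ w ] (CommonSuper u v w × length w ≡ k)) × (∀ w → CommonSuper u v w → k ≤ length w)

IsLCS : Word → Word → Word → Set
IsLCS u v w = CommonSub u v w × LCSLength u v (length w)

IsSCS : Word → Word → Word → Set
IsSCS u v w = CommonSuper u v w × SCSLength u v (length w)

HasCount : (Word → Set) → ℕ → Set
HasCount P m = ∃[ L ] (Unique L × (∀ w → (w ∈ L) ⇔ P w) × length L ≡ m)

mLCS-is : Word → Word → ℕ → Set
mLCS-is u v m = HasCount (IsLCS u v) m

mSCS-is : Word → Word → ℕ → Set
mSCS-is u v m = HasCount (IsSCS u v) m

{-# OPTIONS --safe #-}
-- Both bounds come from the recursion on the first letters of u and v.  A shortest common
-- supersequence w has |w| = |u| + a = |v| + b.  If u and v start with the same letter, so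
-- does w; otherwise w starts with one of the two first letters, which uses up one of the b
-- letters of w missing from v, resp. one of the a letters missing from u.  Pascal's rule
-- then bounds the number of SCSs by C(a+b, a).  For the first inequality, merging u and v
-- along an LCS z gives a common supersequence of length |u| + |v| - |z|; it is shortest
-- because deleting from any common supersequence the letters missing from u or from v leaves
-- a common subsequence.  Reading back the letters that such a merge shares with u and v
-- recovers z, so a single function maps the SCSs onto the LCSs.
module Submission where

open import Defs
open import Data.Bool using (_≟_; if_then_else_)
open import Data.Empty using (⊥-elim)
open import Data.Fin using (zero; suc)
open import Data.Fin.Properties using (injective⇒≤)
open import Data.List using (List; []; _∷_; [_]; length; map; _++_; lookup)
open import Data.List.Properties using (length-map; length-++)
open import Data.List.Membership.Propositional using (_∈_)
open import Data.List.Membership.Propositional.Properties using (∈-lookup; ∈-map⁺; ∈-++⁺ˡ; ∈-++⁺ʳ)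
open import Data.List.Membership.Setoid.Properties using (index-injective)
open import Data.List.Relation.Binary.Equality.Propositional using (≋⇒≡)
open import Data.List.Relation.Binary.Sublist.Propositional using (_⊆_; _∷_; _∷ʳ_; []; minimum; ⊆-refl)
open import Data.List.Relation.Binary.Sublist.Propositional.Properties
  using (length-mono-≤; to-≋; ∷⁻; ∷ʳ⁻)
open import Data.List.Relation.Unary.All as All using ()
open import Data.List.Relation.Unary.AllPairs using (_∷_)
open import Data.List.Relation.Unary.Any using (here; index)
open import Data.List.Relation.Unary.Unique.Propositional using (Unique)
open import Data.Nat using (ℕ; zero; suc; _+_; _∸_; _≤_; z≤n; s≤s)
open import Data.Nat.Combinatorics using (_C_; nCk+nC[k+1]≡[n+1]C[k+1])
open import Data.Nat.Properties
  using ( ≤-refl; ≤-reflexive; ≤-trans; ≤-antisym; ≤-pred; 1+n≰n; <⇒≢; m≤n⇒m≤1+n; suc-injective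
        ; +-comm; +-suc; +-identityʳ; m≤m+n; m≤n+m; +-mono-≤; +-monoʳ-≤; +-cancelʳ-≤; m∸n+n≡m
        ; module ≤-Reasoning)
open import Data.Product using (_×_; _,_; ∃-syntax)
open import Data.Sum using (_⊎_; inj₁; inj₂)
open import Function using (_∘_)
open import Function.Bundles using (Equivalence)
open import Relation.Nullary using (yes; no; does)
open import Relation.Binary.PropositionalEquality
  using (_≡_; _≢_; refl; sym; trans; cong; cong₂; subst; subst₂; setoid; module ≡-Reasoning)

Longest : Word → Word → Word → Set
Longest u v z = ∀ z′ → CommonSub u v z′ → length z′ ≤ length z

Shortest : Word → Word → Word → Set
Shortest u v w = ∀ w′ → CommonSuper u v w′ → length w ≤ length w′

module _ {A : Set} where

  ⊆-≥-length⇒≡ : {xs ys : List A} → xs ⊆ ys → length ys ≤ length xs → xs ≡ ys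
  ⊆-≥-length⇒≡ xs⊆ys ys≤xs = ≋⇒≡ (to-≋ (≤-antisym (length-mono-≤ xs⊆ys) ys≤xs) xs⊆ys)

  ⊆-distinct-heads : {x y : A} {u v z : List A} → x ≢ y →
                     z ⊆ x ∷ u → z ⊆ y ∷ v → z ⊆ u ⊎ z ⊆ v
  ⊆-distinct-heads _   (_ ∷ʳ z⊆u) _           = inj₁ z⊆u
  ⊆-distinct-heads _   (refl ∷ _) (_ ∷ʳ z⊆v) = inj₂ z⊆v
  ⊆-distinct-heads x≢y (refl ∷ _) (refl ∷ _)  = ⊥-elim (x≢y refl)

  commonSub-of-commonSuper : {u v w : List A} → u ⊆ w → v ⊆ w →
    ∃[ z ] z ⊆ u × z ⊆ v × length u + length v ≤ length w + length z
  commonSub-of-commonSuper [] [] = [] , [] , [] , z≤n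
  commonSub-of-commonSuper (c ∷ʳ u⊆w) (.c ∷ʳ v⊆w) with commonSub-of-commonSuper u⊆w v⊆w
  ... | z , z⊆u , z⊆v , bound = z , z⊆u , z⊆v , m≤n⇒m≤1+n bound
  commonSub-of-commonSuper (refl ∷ u⊆w) (c ∷ʳ v⊆w) with commonSub-of-commonSuper u⊆w v⊆w
  ... | z , z⊆u , z⊆v , bound = z , c ∷ʳ z⊆u , z⊆v , s≤s bound
  commonSub-of-commonSuper {u} (c ∷ʳ u⊆w) (refl ∷ v⊆w) with commonSub-of-commonSuper u⊆w v⊆w
  ... | z , z⊆u , z⊆v , bound =
    z , z⊆u , c ∷ʳ z⊆v , ≤-trans (≤-reflexive (+-suc (length u) _)) (s≤s bound)
  commonSub-of-commonSuper {_ ∷ u} {_ ∷ v} {_ ∷ w} (refl ∷ u⊆w) (refl ∷ v⊆w)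
    with commonSub-of-commonSuper u⊆w v⊆w
  ... | z , z⊆u , z⊆v , bound =
    _ ∷ z , refl ∷ z⊆u , refl ∷ z⊆v ,
    s≤s (subst₂ _≤_ (sym (+-suc (length u) (length v))) (sym (+-suc (length w) (length z)))
                    (s≤s bound))

  Unique-lookup-injective : {xs : List A} → Unique xs →
                            ∀ {i j} → lookup xs i ≡ lookup xs j → i ≡ j
  Unique-lookup-injective (_ ∷ _)    {zero}  {zero}  _  = refl
  Unique-lookup-injective (x∉xs ∷ _) {zero}  {suc j} eq = ⊥-elim (All.lookup x∉xs (∈-lookup j) eq)
  Unique-lookup-injective (x∉xs ∷ _) {suc i} {zero}  eq =
    ⊥-elim (All.lookup x∉xs (∈-lookup i) (sym eq))
  Unique-lookup-injective (_ ∷ xs!)  {suc i} {suc j} eq = cong suc (Unique-lookup-injective xs! eq)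

  Unique-length-≤ : {xs ys : List A} → Unique xs → (∀ {z} → z ∈ xs → z ∈ ys) →
                    length xs ≤ length ys
  Unique-length-≤ {xs} {ys} xs! xs⊆ys = injective⇒≤ {f = λ i → index (inYs i)} λ {i} {j} eq →
    Unique-lookup-injective xs! (index-injective (setoid A) (inYs i) (inYs j) eq)
    where
    inYs : ∀ i → lookup xs i ∈ ys
    inYs i = xs⊆ys (∈-lookup i)

C-≤-suc : ∀ n k → n C k ≤ suc n C suc k
C-≤-suc n k = subst (n C k ≤_) (nCk+nC[k+1]≡[n+1]C[k+1] n k) (m≤m+n _ _)

C-positive : ∀ a b → 1 ≤ (a + b) C a
C-positive zero    b = ≤-refl
C-positive (suc a) b = ≤-trans (C-positive a b) (C-≤-suc (a + b) a)

C-pascal : ∀ a b → (suc a + b) C suc a + (a + suc b) C a ≡ (suc a + suc b) C suc a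
C-pascal a b = begin
  suc (a + b) C suc a + (a + suc b) C a   ≡⟨ cong (λ n → suc (a + b) C suc a + n C a) (+-suc a b) ⟩
  suc (a + b) C suc a + suc (a + b) C a   ≡⟨ +-comm (suc (a + b) C suc a) _ ⟩
  suc (a + b) C a + suc (a + b) C suc a   ≡⟨ nCk+nC[k+1]≡[n+1]C[k+1] (suc (a + b)) a ⟩
  suc (suc (a + b)) C suc a               ≡⟨ cong (λ n → suc n C suc a) (+-suc a b) ⟨
  (suc a + suc b) C suc a                 ∎
  where open ≡-Reasoning

SCSLength-unique : ∀ {u v m n} → SCSLength u v m → SCSLength u v n → m ≡ n
SCSLength-unique ((w , super , refl) , shortest) ((w′ , super′ , refl) , shortest′) =
  ≤-antisym (shortest w′ super′) (shortest′ w super)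

-- On an SCS w of u and v: the letters of w matched in both u and v, which form an LCS.
lcsOfSCS : Word → Word → Word → Word
lcsOfSCS (x ∷ u) (y ∷ v) (c ∷ w) with x ≟ y | c ≟ x
... | yes _ | _     = x ∷ lcsOfSCS u v w
... | no _  | yes _ = lcsOfSCS u (y ∷ v) w
... | no _  | no _  = lcsOfSCS (x ∷ u) v w
lcsOfSCS _ _ _ = []

lcsOfSCS-same-heads : ∀ x u v w → lcsOfSCS (x ∷ u) (x ∷ v) (x ∷ w) ≡ x ∷ lcsOfSCS u v w
lcsOfSCS-same-heads x u v w with x ≟ x
... | yes _  = refl
... | no x≢x = ⊥-elim (x≢x refl)

lcsOfSCS-left : ∀ {x y} u v w → x ≢ y →
                lcsOfSCS (x ∷ u) (y ∷ v) (x ∷ w) ≡ lcsOfSCS u (y ∷ v) w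
lcsOfSCS-left {x} {y} u v w x≢y with x ≟ y | x ≟ x
... | yes x≡y | _     = ⊥-elim (x≢y x≡y)
... | no _    | yes _ = refl
... | no _    | no x≢x = ⊥-elim (x≢x refl)

lcsOfSCS-right : ∀ {x y} u v w → x ≢ y →
                 lcsOfSCS (x ∷ u) (y ∷ v) (y ∷ w) ≡ lcsOfSCS (x ∷ u) v w
lcsOfSCS-right {x} {y} u v w x≢y with x ≟ y | y ≟ x
... | yes x≡y | _       = ⊥-elim (x≢y x≡y)
... | no _    | yes y≡x = ⊥-elim (x≢y (sym y≡x))
... | no _    | no _    = refl

merge-along-longest : ∀ u v {z} → CommonSub u v z → Longest u v z →
  ∃[ w ] CommonSuper u v w × length w + length z ≡ length u + length v × lcsOfSCS u v w ≡ z
merge-along-longest [] v ([] , _) _ = v , (minimum v , ⊆-refl) , +-identityʳ _ , refl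
merge-along-longest (x ∷ u) [] (_ , []) _ = x ∷ u , (⊆-refl , minimum _) , refl , refl
merge-along-longest (x ∷ u) (y ∷ v) {z} (z⊆xu , z⊆yv) longest
  with x ≟ y | merge-along-longest u v | merge-along-longest u (y ∷ v)
             | merge-along-longest (x ∷ u) v
merge-along-longest (x ∷ u) (_ ∷ v) {[]} _ longest | yes refl | _ | _ | _ =
  ⊥-elim (1+n≰n (longest (x ∷ []) (refl ∷ minimum u , refl ∷ minimum v)))
merge-along-longest (x ∷ u) (_ ∷ v) {c ∷ z} (z⊆xu , z⊆xv) longest | yes refl | mergeTails | _ | _
  with c ≟ x
... | no c≢x =
  ⊥-elim (1+n≰n (longest (x ∷ c ∷ z) (refl ∷ ∷ʳ⁻ c≢x z⊆xu , refl ∷ ∷ʳ⁻ c≢x z⊆xv)))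
... | yes refl =
  let w , (u⊆w , v⊆w) , merged , back =
        mergeTails (∷⁻ z⊆xu , ∷⁻ z⊆xv)
                   (λ z′ (p , q) → ≤-pred (longest (x ∷ z′) (refl ∷ p , refl ∷ q)))
  in x ∷ w , (refl ∷ u⊆w , refl ∷ v⊆w) ,
     cong suc (trans (+-suc (length w) _) (trans (cong suc merged) (sym (+-suc (length u) _)))) ,
     trans (lcsOfSCS-same-heads x u v w) (cong (x ∷_) back)
merge-along-longest (x ∷ u) (y ∷ v) {z} (z⊆xu , z⊆yv) longest | no x≢y | _ | mergeLeft | mergeRight
  with ⊆-distinct-heads x≢y z⊆xu z⊆yv
... | inj₁ z⊆u =
  let w , (u⊆w , yv⊆w) , merged , back =
        mergeLeft (z⊆u , z⊆yv) (λ z′ (p , q) → longest z′ (x ∷ʳ p , q))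
  in x ∷ w , (refl ∷ u⊆w , x ∷ʳ yv⊆w) , cong suc merged , trans (lcsOfSCS-left u v w x≢y) back
... | inj₂ z⊆v =
  let w , (xu⊆w , v⊆w) , merged , back =
        mergeRight (z⊆xu , z⊆v) (λ z′ (p , q) → longest z′ (p , y ∷ʳ q))
  in y ∷ w , (y ∷ʳ xu⊆w , refl ∷ v⊆w) , cong suc (trans merged (sym (+-suc (length u) _))) ,
     trans (lcsOfSCS-right u v w x≢y) back

lcs⇒scs : ∀ {u v z} → IsLCS u v z → ∃[ w ] IsSCS u v w × lcsOfSCS u v w ≡ z
lcs⇒scs {u} {v} {z} (sub , _ , longest) =
  let w , super , merged , back = merge-along-longest u v sub longest
      shortest : Shortest u v w
      shortest w′ (u⊆w′ , v⊆w′) =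
        let z′ , z′⊆u , z′⊆v , bound = commonSub-of-commonSuper u⊆w′ v⊆w′
        in +-cancelʳ-≤ (length z) (length w) (length w′) (begin
             length w + length z   ≡⟨ merged ⟩
             length u + length v   ≤⟨ bound ⟩
             length w′ + length z′ ≤⟨ +-monoʳ-≤ (length w′) (longest z′ (z′⊆u , z′⊆v)) ⟩
             length w′ + length z  ∎)
  in w , (super , (w , super , refl) , shortest) , back
  where open ≤-Reasoning

spend : {X : Set} → ℕ → (ℕ → List X) → List X
spend zero    _ = []
spend (suc k) f = f k

length-spend-pascal : {X : Set} (L R : ℕ → ℕ → List X) →
  (∀ a b → length (L a b) ≤ (a + b) C a) → (∀ a b → length (R a b) ≤ (a + b) C a) →
  ∀ a b → length (spend b (L a)) + length (spend a λ a′ → R a′ b) ≤ (a + b) C a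
length-spend-pascal L R boundL boundR zero    zero    = z≤n
length-spend-pascal L R boundL boundR zero    (suc b) =
  ≤-trans (≤-reflexive (+-identityʳ _)) (boundL zero b)
length-spend-pascal L R boundL boundR (suc a) zero    =
  ≤-trans (boundR a zero) (C-≤-suc (a + zero) a)
length-spend-pascal L R boundL boundR (suc a) (suc b) =
  ≤-trans (+-mono-≤ (boundL (suc a) b) (boundR a (suc b))) (≤-reflexive (C-pascal a b))

-- A and B count the letters of a candidate w missing from u, resp. v: |w| = |u| + A = |v| + B.
scsCandidates : Word → Word → ℕ → ℕ → List Word
scsCandidates []      v       _ _ = [ v ]
scsCandidates (x ∷ u) []      _ _ = [ x ∷ u ]
scsCandidates (x ∷ u) (y ∷ v) A B =
  if does (x ≟ y)
  then map (x ∷_) (scsCandidates u v A B)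
  else map (x ∷_) (spend B (scsCandidates u (y ∷ v) A))
    ++ map (y ∷_) (spend A λ A′ → scsCandidates (x ∷ u) v A′ B)

length-scsCandidates : ∀ u v A B → length (scsCandidates u v A B) ≤ (A + B) C A
length-scsCandidates []      v  A B = C-positive A B
length-scsCandidates (x ∷ u) [] A B = C-positive A B
length-scsCandidates (x ∷ u) (y ∷ v) A B
  with x ≟ y | length-scsCandidates u v | length-scsCandidates u (y ∷ v)
             | length-scsCandidates (x ∷ u) v
... | yes _ | boundTails | _ | _ =
  ≤-trans (≤-reflexive (length-map (x ∷_) (scsCandidates u v A B))) (boundTails A B)
... | no _  | _ | boundLeft | boundRight = begin
  length (map (x ∷_) left ++ map (y ∷_) right)
    ≡⟨ length-++ (map (x ∷_) left) ⟩
  length (map (x ∷_) left) + length (map (y ∷_) right)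
    ≡⟨ cong₂ _+_ (length-map (x ∷_) left) (length-map (y ∷_) right) ⟩
  length left + length right
    ≤⟨ length-spend-pascal (scsCandidates u (y ∷ v)) (scsCandidates (x ∷ u) v) boundLeft boundRight A B ⟩
  (A + B) C A
    ∎
  where
  open ≤-Reasoning
  left right : List Word
  left  = spend B (scsCandidates u (y ∷ v) A)
  right = spend A λ A′ → scsCandidates (x ∷ u) v A′ B

scsCandidates-complete : ∀ u v A B {w} → CommonSuper u v w → Shortest u v w →
  length w ≡ length u + A → length w ≡ length v + B → w ∈ scsCandidates u v A B
scsCandidates-complete [] v A B (_ , v⊆w) shortest _ _ =
  here (sym (⊆-≥-length⇒≡ v⊆w (shortest v (minimum v , ⊆-refl))))
scsCandidates-complete (x ∷ u) [] A B (xu⊆w , _) shortest _ _ =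
  here (sym (⊆-≥-length⇒≡ xu⊆w (shortest (x ∷ u) (⊆-refl , minimum _))))
scsCandidates-complete (x ∷ u) (y ∷ v) A B {c ∷ w} (xu⊆cw , yv⊆cw) shortest lenᵤ lenᵥ
  with x ≟ y | c ≟ x
... | yes refl | yes refl =
  ∈-map⁺ (x ∷_) (scsCandidates-complete u v A B (∷⁻ xu⊆cw , ∷⁻ yv⊆cw)
    (λ w′ (p , q) → ≤-pred (shortest (x ∷ w′) (refl ∷ p , refl ∷ q)))
    (suc-injective lenᵤ) (suc-injective lenᵥ))
... | yes refl | no c≢x =
  ⊥-elim (1+n≰n (shortest w (∷ʳ⁻ (c≢x ∘ sym) xu⊆cw , ∷ʳ⁻ (c≢x ∘ sym) yv⊆cw)))
... | no x≢y | yes refl = ∈-++⁺ˡ (∈-map⁺ (x ∷_) (viaLeft B lenᵥ))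
  where
  yv⊆w : y ∷ v ⊆ w
  yv⊆w = ∷ʳ⁻ (x≢y ∘ sym) yv⊆cw
  viaLeft : ∀ B → suc (length w) ≡ suc (length v + B) → w ∈ spend B (scsCandidates u (y ∷ v) A)
  viaLeft zero    lenᵥ =
    ⊥-elim (<⇒≢ (length-mono-≤ yv⊆w) (sym (trans (suc-injective lenᵥ) (+-identityʳ _))))
  viaLeft (suc B) lenᵥ = scsCandidates-complete u (y ∷ v) A B (∷⁻ xu⊆cw , yv⊆w)
    (λ w′ (p , q) → ≤-pred (shortest (x ∷ w′) (refl ∷ p , x ∷ʳ q)))
    (suc-injective lenᵤ) (trans (suc-injective lenᵥ) (+-suc _ _))
... | no x≢y | no c≢x with c ≟ y
...   | yes refl = ∈-++⁺ʳ (map (x ∷_) _) (∈-map⁺ (y ∷_) (viaRight A lenᵤ))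
  where
  xu⊆w : x ∷ u ⊆ w
  xu⊆w = ∷ʳ⁻ x≢y xu⊆cw
  viaRight : ∀ A → suc (length w) ≡ suc (length u + A) →
             w ∈ spend A λ A′ → scsCandidates (x ∷ u) v A′ B
  viaRight zero    lenᵤ =
    ⊥-elim (<⇒≢ (length-mono-≤ xu⊆w) (sym (trans (suc-injective lenᵤ) (+-identityʳ _))))
  viaRight (suc A) lenᵤ = scsCandidates-complete (x ∷ u) v A B (xu⊆w , ∷⁻ yv⊆cw)
    (λ w′ (p , q) → ≤-pred (shortest (c ∷ w′) (c ∷ʳ p , refl ∷ q)))
    (trans (suc-injective lenᵤ) (+-suc _ _)) (suc-injective lenᵥ)
...   | no c≢y =
  ⊥-elim (1+n≰n (shortest w (∷ʳ⁻ (c≢x ∘ sym) xu⊆cw , ∷ʳ⁻ (c≢y ∘ sym) yv⊆cw)))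

mLCS≤mSCS : ∀ {u v mL mS} → mLCS-is u v mL → mSCS-is u v mS → mL ≤ mS
mLCS≤mSCS {u} {v} (LCSs , LCSs! , isLCS⇔ , refl) (SCSs , _ , isSCS⇔ , refl) = begin
  length LCSs                        ≤⟨ Unique-length-≤ LCSs! lcsOfSCS-onto ⟩
  length (map (lcsOfSCS u v) SCSs)   ≡⟨ length-map (lcsOfSCS u v) SCSs ⟩
  length SCSs                        ∎
  where
  open ≤-Reasoning
  lcsOfSCS-onto : ∀ {z} → z ∈ LCSs → z ∈ map (lcsOfSCS u v) SCSs
  lcsOfSCS-onto {z} z∈LCSs =
    let w , isSCS , back = lcs⇒scs (Equivalence.to (isLCS⇔ z) z∈LCSs)
    in subst (_∈ map (lcsOfSCS u v) SCSs) back
             (∈-map⁺ (lcsOfSCS u v) (Equivalence.from (isSCS⇔ w) isSCS))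

mSCS≤binomial : ∀ {u v n a b m} → SCSLength u v n → n ≡ length u + a → n ≡ length v + b →
                mSCS-is u v m → m ≤ (a + b) C a
mSCS≤binomial {u} {v} {a = a} {b} scsLength n≡∣u∣+a n≡∣v∣+b (SCSs , SCSs! , isSCS⇔ , refl) =
  ≤-trans (Unique-length-≤ SCSs! SCS∈candidates) (length-scsCandidates u v a b)
  where
  SCS∈candidates : ∀ {w} → w ∈ SCSs → w ∈ scsCandidates u v a b
  SCS∈candidates {w} w∈SCSs =
    let super , scsLength-w@(_ , shortest) = Equivalence.to (isSCS⇔ w) w∈SCSs
        ∣w∣≡n = SCSLength-unique scsLength-w scsLength
    in scsCandidates-complete u v a b super shortest
         (trans ∣w∣≡n n≡∣u∣+a) (trans ∣w∣≡n n≡∣v∣+b)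

theorem1p3 : (n a b : ℕ) → a + b ≤ n → (u v : Word) →
    length u ≡ n ∸ a → length v ≡ n ∸ b → SCSLength u v n →
    (mL mS : ℕ) → mLCS-is u v mL → mSCS-is u v mS →
    (mL ≤ mS) × (mS ≤ (a + b) C a)
theorem1p3 n a b a+b≤n u v ∣u∣ ∣v∣ scsLength mL mS mLCS mSCS =
  mLCS≤mSCS mLCS mSCS ,
  mSCS≤binomial scsLength (n≡m+k ∣u∣ (≤-trans (m≤m+n a b) a+b≤n))
                          (n≡m+k ∣v∣ (≤-trans (m≤n+m b a) a+b≤n)) mSCS
  where
  n≡m+k : ∀ {m k} → m ≡ n ∸ k → k ≤ n → n ≡ m + k
  n≡m+k {k = k} m≡n∸k k≤n = sym (trans (cong (_+ k) m≡n∸k) (m∸n+n≡m k≤n))
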